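{- For every term $r$ and types $A,B$: if $r:A$ and $r:B$, then $A\equiv B$.
   Context: Types: $A,B,C::=\tau\mid A\Rightarrow B\mid A\wedge B$ with a single atomic type $\tau$. $\equiv$ is the smallest congruence on types containing $A\wedge B\equiv B\wedge A$, $(A\wedge B)\wedge C\equiv A\wedge(B\wedge C)$, $A\Rightarrow(B\wedge C)\equiv(A\Rightarrow B)\wedge(A\Rightarrow C)$, $(A\wedge B)\Rightarrow C\equiv A\Rightarrow B\Rightarrow C$. Terms: $r,s,t::=x^A\mid \lambda x^A.r\mid r\,s\mid r+s\mid \pi_A(r)$; every variable occurrence carries a type label; terms up to $\alpha$-equivalence. $\mathrm{vars}(r)$ is the set of labelled variables (free and bound) of $r$. A set of labelled variables is functional if $x^A,x^B$ in it implies $A=B$. Typing (judgements $r:A$, no contexts): $x^A:A$; if $r:A$ and $A\equiv B$ then $r:B$; if $r:B$ and $\mathrm{vars}(r)\cup\{x^A\}$ functional then $\lambda x^A.r:A\Rightarrow B$; if $r:A\Rightarrow B$, $s:A$, $\mathrm{vars}(rs)$ functional then $rs:B$; if $r:A$, $s:B$, $\mathrm{vars}(r+s)$ functional then $r+s:A\wedge B$; if $r:A$ then $\pi_A(r):A$; if $r:A\wedge B$ then $\pi_A(r):A$. -}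

module Defs where

open import Data.Nat using (ℕ)
open import Relation.Binary.PropositionalEquality using (_≡_)

infixr 7 _⇒_
infixr 8 _∧_

data Type : Set where
  τ   : Type
  _⇒_ : Type → Type → Type
  _∧_ : Type → Type → Type

-- ≡ on types: smallest congruence containing the four isomorphisms
infix 4 _≅_
data _≅_ : Type → Type → Set where
  ≅-refl  : ∀ {A} → A ≅ A
  ≅-sym   : ∀ {A B} → A ≅ B → B ≅ A
  ≅-trans : ∀ {A B C} → A ≅ B → B ≅ C → A ≅ C
  ≅-⇒     : ∀ {A A' B B'} → A ≅ A' → B ≅ B' → (A ⇒ B) ≅ (A' ⇒ B')
  ≅-∧     : ∀ {A A' B B'} → A ≅ A' → B ≅ B' → (A ∧ B) ≅ (A' ∧ B')
  comm    : ∀ {A B} → (A ∧ B) ≅ (B ∧ A)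
  asso    : ∀ {A B C} → ((A ∧ B) ∧ C) ≅ (A ∧ (B ∧ C))
  dist    : ∀ {A B C} → (A ⇒ (B ∧ C)) ≅ ((A ⇒ B) ∧ (A ⇒ C))
  curry   : ∀ {A B C} → ((A ∧ B) ⇒ C) ≅ (A ⇒ (B ⇒ C))

Name : Set
Name = ℕ

data Term : Set where
  var  : Name → Type → Term
  lam  : Name → Type → Term → Term
  app  : Term → Term → Term
  plus : Term → Term → Term
  proj : Type → Term → Term

data _∈vars_ : Name → Type → Term → Set where
  in-var   : ∀ {x A} → _∈vars_ x A (var x A)
  in-lam-b : ∀ {x A r} → _∈vars_ x A (lam x A r)
  in-lam   : ∀ {x A y B r} → _∈vars_ x A r → _∈vars_ x A (lam y B r)
  in-appˡ  : ∀ {x A r s} → _∈vars_ x A r → _∈vars_ x A (app r s)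
  in-appʳ  : ∀ {x A r s} → _∈vars_ x A s → _∈vars_ x A (app r s)
  in-plusˡ : ∀ {x A r s} → _∈vars_ x A r → _∈vars_ x A (plus r s)
  in-plusʳ : ∀ {x A r s} → _∈vars_ x A s → _∈vars_ x A (plus r s)
  in-proj  : ∀ {x A B r} → _∈vars_ x A r → _∈vars_ x A (proj B r)

Functional : Term → Set
Functional r = ∀ {x A B} → _∈vars_ x A r → _∈vars_ x B r → A ≡ B

FunctionalWith : Name → Type → Term → Set
FunctionalWith x A r = Functional r × (∀ {B} → _∈vars_ x B r → B ≡ A)
  where open import Data.Product using (_×_)

infix 4 _∶_
data _∶_ : Term → Type → Set where
  ty-var  : ∀ {x A} → var x A ∶ A
  ty-≅    : ∀ {r A B} → r ∶ A → A ≅ B → r ∶ B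
  ty-lam  : ∀ {x A r B} → r ∶ B → FunctionalWith x A r → lam x A r ∶ (A ⇒ B)
  ty-app  : ∀ {r s A B} → r ∶ (A ⇒ B) → s ∶ A → Functional (app r s) → app r s ∶ B
  ty-plus : ∀ {r s A B} → r ∶ A → s ∶ B → Functional (plus r s) → plus r s ∶ (A ∧ B)
  ty-proj : ∀ {r A} → r ∶ A → proj A r ∶ A
  ty-proj∧ : ∀ {r A B} → r ∶ (A ∧ B) → proj A r ∶ A

-- Every type is ≅ to a conjunction of prime types A₁ ⇒ ⋯ ⇒ Aₙ ⇒ τ whose premises
-- are again primes, and this normal form is unique up to permuting conjuncts and
-- premises at every level.  The normal form of A ⇒ B is that of B with the primes of
-- A added as premises to each of its conjuncts, and adding premises can be cancelled
-- in the multiset of premises; hence A ⇒ B ≅ A ⇒ B' implies B ≅ B'.  Uniqueness of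
-- typing then follows by induction on two typing derivations, the application case
-- being the one that needs this cancellation.
module Submission where

open import Defs
open import Algebra.Definitions using (Congruent₂)
open import Algebra.Structures using (IsCommutativeMonoid)
open import Data.Empty using (⊥-elim)
open import Data.List using (List; []; _∷_; _++_; [_]; map; foldr)
open import Data.List.Properties using (++-assoc; map-++; map-∘; map-cong)
open import Data.List.Membership.Propositional using (find)
open import Data.List.Membership.Propositional.Properties using (∈-∃++)
open import Data.List.Relation.Binary.Pointwise using (Pointwise; []; _∷_)
open import Data.List.Relation.Binary.Permutation.Homogeneous using (Permutation; refl; prep; swap; trans)
import Data.List.Relation.Binary.Permutation.Setoid as Perm
import Data.List.Relation.Binary.Permutation.Setoid.Properties as PermProperties
open import Data.List.Relation.Unary.Any using (here)
import Data.List.Relation.Unary.Any.Properties as Any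
open import Data.Maybe using (Maybe; just; nothing)
open import Data.Maybe.Relation.Binary.Pointwise as Maybe using (just; nothing)
open import Data.Product using (_,_)
open import Function using (_∘_)
open import Relation.Binary.Bundles using (Setoid)
open import Relation.Binary.Definitions using (Reflexive; Symmetric; Transitive)
open import Relation.Binary.PropositionalEquality using (_≡_; refl; cong)
import Relation.Binary.PropositionalEquality as ≡
import Relation.Binary.Reasoning.Setoid as SetoidReasoning

module _ {a b ℓ₁ ℓ₂} (S : Setoid a ℓ₁) (T : Setoid b ℓ₂) where
  open Setoid S using () renaming (Carrier to A; _≈_ to _≈₁_)
  open Setoid T using () renaming (Carrier to B; _≈_ to _≈₂_)
  open Perm S using (↭-refl; ↭-sym; ↭-trans) renaming (_↭_ to _↭₁_)
  open Perm T using (module PermutationReasoning) renaming (_↭_ to _↭₂_)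
  private
    module P₁ = PermProperties S
    module P₂ = PermProperties T

  ↭-map⁻ : ∀ {f : A → B} → (∀ {x y} → f x ≈₂ f y → x ≈₁ y) →
           ∀ xs {ys} → map f xs ↭₂ map f ys → xs ↭₁ ys
  ↭-map⁻ inj [] {[]} _ = ↭-refl
  ↭-map⁻ inj [] {_ ∷ _} p = ⊥-elim (P₂.¬x∷xs↭[] (Perm.↭-sym T p))
  ↭-map⁻ {f} inj (x ∷ xs) p
    with y , y∈ys , fx≈fy ← find (Any.map⁻ (P₂.∈-resp-↭ p (here (Setoid.refl T))))
    with ys₁ , ys₂ , refl ← ∈-∃++ y∈ys
    = ↭-trans (prep (Setoid.refl S) (↭-map⁻ inj xs map-rest))
              (↭-sym (P₁.shift (inj (Setoid.sym T fx≈fy)) ys₁ ys₂))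
    where
    open PermutationReasoning
    map-rest : map f xs ↭₂ map f (ys₁ ++ ys₂)
    map-rest = P₂.drop-∷ (begin
      f x ∷ map f xs                     ↭⟨ p ⟩
      map f (ys₁ ++ y ∷ ys₂)             ≡⟨ map-++ f ys₁ (y ∷ ys₂) ⟩
      map f ys₁ ++ [ f y ] ++ map f ys₂  ↭⟨ P₂.shift (Setoid.sym T fx≈fy) (map f ys₁) (map f ys₂) ⟩
      f x ∷ map f ys₁ ++ map f ys₂       ≡⟨ cong (f x ∷_) (map-++ f ys₁ ys₂) ⟨
      f x ∷ map f (ys₁ ++ ys₂)           ∎)

-- as ⇒τ stands for the prime type a₁ ⇒ ⋯ ⇒ aₙ ⇒ τ (see ⟦_⟧ᵖ below).
data Prime : Set where
  _⇒τ : List Prime → Prime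

infix 4 _≈ᵖ_
data _≈ᵖ_ : Prime → Prime → Set where
  _⇒τ : ∀ {as bs} → Permutation _≈ᵖ_ as bs → as ⇒τ ≈ᵖ bs ⇒τ

≈ᵖ-refl : Reflexive _≈ᵖ_
≋ᵖ-refl : Reflexive (Pointwise _≈ᵖ_)
≈ᵖ-refl {as ⇒τ} = refl ≋ᵖ-refl ⇒τ
≋ᵖ-refl {[]}    = []
≋ᵖ-refl {_ ∷ _} = ≈ᵖ-refl ∷ ≋ᵖ-refl

-- The library's symmetry of Permutation takes the symmetry of ≈ᵖ as an argument,
-- which hides the structural recursion from the termination checker.
≈ᵖ-sym : Symmetric _≈ᵖ_
↭ᵖ-sym : Symmetric (Permutation _≈ᵖ_)
≋ᵖ-sym : Symmetric (Pointwise _≈ᵖ_)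
≈ᵖ-sym (p ⇒τ) = ↭ᵖ-sym p ⇒τ
↭ᵖ-sym (refl ps)    = refl (≋ᵖ-sym ps)
↭ᵖ-sym (prep e p)   = prep (≈ᵖ-sym e) (↭ᵖ-sym p)
↭ᵖ-sym (swap e f p) = swap (≈ᵖ-sym f) (≈ᵖ-sym e) (↭ᵖ-sym p)
↭ᵖ-sym (trans p q)  = trans (↭ᵖ-sym q) (↭ᵖ-sym p)
≋ᵖ-sym []       = []
≋ᵖ-sym (e ∷ es) = ≈ᵖ-sym e ∷ ≋ᵖ-sym es

≈ᵖ-trans : Transitive _≈ᵖ_
≈ᵖ-trans (p ⇒τ) (q ⇒τ) = trans p q ⇒τ

≈ᵖ-setoid : Setoid _ _
≈ᵖ-setoid = record
  { Carrier       = Prime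
  ; _≈_           = _≈ᵖ_
  ; isEquivalence = record { refl = ≈ᵖ-refl ; sym = ≈ᵖ-sym ; trans = ≈ᵖ-trans }
  }

open Perm ≈ᵖ-setoid using (_↭_; ↭-refl; ↭-sym; ↭-trans; ↭-reflexive)
open PermProperties ≈ᵖ-setoid using (++⁺; ++⁺ʳ; ++⁺ˡ; ++-comm; dropMiddle)

infixr 5 _⇒ᵖ_
_⇒ᵖ_ : List Prime → Prime → Prime
X ⇒ᵖ (as ⇒τ) = (X ++ as) ⇒τ

⇒ᵖ-congˡ : ∀ {X Y} → X ↭ Y → ∀ p → X ⇒ᵖ p ≈ᵖ Y ⇒ᵖ p
⇒ᵖ-congˡ e (as ⇒τ) = ++⁺ʳ as e ⇒τ

⇒ᵖ-congʳ : ∀ X {p q} → p ≈ᵖ q → X ⇒ᵖ p ≈ᵖ X ⇒ᵖ q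
⇒ᵖ-congʳ X (e ⇒τ) = ++⁺ˡ X e ⇒τ

⇒ᵖ-cancelˡ : ∀ X {p q} → X ⇒ᵖ p ≈ᵖ X ⇒ᵖ q → p ≈ᵖ q
⇒ᵖ-cancelˡ X {_ ⇒τ} {_ ⇒τ} (e ⇒τ) = dropMiddle [] [] e ⇒τ

⇒ᵖ-++ : ∀ X Y p → (X ++ Y) ⇒ᵖ p ≡ X ⇒ᵖ Y ⇒ᵖ p
⇒ᵖ-++ X Y (as ⇒τ) = cong _⇒τ (++-assoc X Y as)

map-⇒ᵖ-congˡ : ∀ {X Y} → X ↭ Y → ∀ ps → map (X ⇒ᵖ_) ps ↭ map (Y ⇒ᵖ_) ps
map-⇒ᵖ-congˡ e []       = ↭-refl
map-⇒ᵖ-congˡ e (p ∷ ps) = prep (⇒ᵖ-congˡ e p) (map-⇒ᵖ-congˡ e ps)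

nf : Type → List Prime
nf τ       = [ [] ⇒τ ]
nf (A ∧ B) = nf A ++ nf B
nf (A ⇒ B) = map (nf A ⇒ᵖ_) (nf B)

≅⇒nf↭ : ∀ {A B} → A ≅ B → nf A ↭ nf B
≅⇒nf↭ ≅-refl        = ↭-refl
≅⇒nf↭ (≅-sym e)     = ↭-sym (≅⇒nf↭ e)
≅⇒nf↭ (≅-trans e f) = ↭-trans (≅⇒nf↭ e) (≅⇒nf↭ f)
≅⇒nf↭ (≅-⇒ {A' = A'} {B = B} e f) =
  ↭-trans (map-⇒ᵖ-congˡ (≅⇒nf↭ e) (nf B))
          (PermProperties.map⁺ ≈ᵖ-setoid ≈ᵖ-setoid (⇒ᵖ-congʳ (nf A')) (≅⇒nf↭ f))
≅⇒nf↭ (≅-∧ e f)     = ++⁺ (≅⇒nf↭ e) (≅⇒nf↭ f)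
≅⇒nf↭ (comm {A} {B}) = ++-comm (nf A) (nf B)
≅⇒nf↭ (asso {A} {B} {C}) = ↭-reflexive (++-assoc (nf A) (nf B) (nf C))
≅⇒nf↭ (dist {A} {B} {C}) = ↭-reflexive (map-++ (nf A ⇒ᵖ_) (nf B) (nf C))
≅⇒nf↭ (curry {A} {B} {C}) =
  ↭-reflexive (≡.trans (map-cong (⇒ᵖ-++ (nf A) (nf B)) (nf C)) (map-∘ (nf C)))

infixr 7 _⇒*_
⟦_⟧ᵖ : Prime → Type
_⇒*_ : List Prime → Type → Type
⟦ as ⇒τ ⟧ᵖ     = as ⇒* τ
[] ⇒* B       = B
(a ∷ as) ⇒* B = ⟦ a ⟧ᵖ ⇒ as ⇒* B

⟦⟧ᵖ-cong : ∀ {p q} → p ≈ᵖ q → ⟦ p ⟧ᵖ ≅ ⟦ q ⟧ᵖ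
⇒*-cong : ∀ {as bs B} → as ↭ bs → as ⇒* B ≅ bs ⇒* B
⇒*-cong-≋ : ∀ {as bs B} → Pointwise _≈ᵖ_ as bs → as ⇒* B ≅ bs ⇒* B
⟦⟧ᵖ-cong (p ⇒τ) = ⇒*-cong p
⇒*-cong (refl ps)    = ⇒*-cong-≋ ps
⇒*-cong (prep e p)   = ≅-⇒ (⟦⟧ᵖ-cong e) (⇒*-cong p)
⇒*-cong (swap e f p) =
  ≅-trans (≅-sym curry)
          (≅-trans (≅-⇒ (≅-trans comm (≅-∧ (⟦⟧ᵖ-cong f) (⟦⟧ᵖ-cong e))) (⇒*-cong p)) curry)
⇒*-cong (trans p q)  = ≅-trans (⇒*-cong p) (⇒*-cong q)
⇒*-cong-≋ []       = ≅-refl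
⇒*-cong-≋ (e ∷ es) = ≅-⇒ (⟦⟧ᵖ-cong e) (⇒*-cong-≋ es)

⇒*-++ : ∀ X Y B → (X ++ Y) ⇒* B ≡ X ⇒* Y ⇒* B
⇒*-++ []      Y B = refl
⇒*-++ (x ∷ X) Y B = cong (⟦ x ⟧ᵖ ⇒_) (⇒*-++ X Y B)

-- Maybe Type adjoins a unit ⊤ = nothing, standing for the empty conjunction, with
-- the laws A ∧ ⊤ ≅ A, ⊤ ⇒ B ≅ B and A ⇒ ⊤ ≅ ⊤.  The meaning ⋀ of a list of primes
-- then needs no case for the empty list and is a monoid morphism for _++_.
infixr 8 _⊓_
_⊓_ : Maybe Type → Maybe Type → Maybe Type
nothing ⊓ B      = B
just A  ⊓ nothing = just A
just A  ⊓ just B  = just (A ∧ B)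

infixr 7 _⇛_
_⇛_ : Maybe Type → Maybe Type → Maybe Type
nothing ⇛ B      = B
just A  ⇛ nothing = nothing
just A  ⇛ just B  = just (A ⇒ B)

≅-setoid : Setoid _ _
≅-setoid = record
  { Carrier       = Type
  ; _≈_           = _≅_
  ; isEquivalence = record { refl = ≅-refl ; sym = ≅-sym ; trans = ≅-trans }
  }

≃-setoid : Setoid _ _
≃-setoid = Maybe.setoid ≅-setoid

open Setoid ≃-setoid using () renaming (_≈_ to _≃_; refl to ≃-refl; sym to ≃-sym; trans to ≃-trans)

⊓-cong : Congruent₂ _≃_ _⊓_
⊓-cong nothing  q        = q
⊓-cong (just e) nothing  = just e
⊓-cong (just e) (just f) = just (≅-∧ e f)

⇛-cong : Congruent₂ _≃_ _⇛_
⇛-cong nothing  q        = q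
⇛-cong (just e) nothing  = nothing
⇛-cong (just e) (just f) = just (≅-⇒ e f)

⊓-assoc : ∀ x y z → (x ⊓ y) ⊓ z ≃ x ⊓ y ⊓ z
⊓-assoc nothing  _        _        = ≃-refl
⊓-assoc (just _) nothing  _        = ≃-refl
⊓-assoc (just _) (just _) nothing  = ≃-refl
⊓-assoc (just _) (just _) (just _) = just asso

⊓-comm : ∀ x y → x ⊓ y ≃ y ⊓ x
⊓-comm nothing  nothing  = nothing
⊓-comm nothing  (just _) = ≃-refl
⊓-comm (just _) nothing  = ≃-refl
⊓-comm (just _) (just _) = just comm

⊓-identityʳ : ∀ x → x ⊓ nothing ≃ x
⊓-identityʳ nothing  = nothing
⊓-identityʳ (just _) = ≃-refl

⊓-isCommutativeMonoid : IsCommutativeMonoid _≃_ _⊓_ nothing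
⊓-isCommutativeMonoid = record
  { isMonoid = record
    { isSemigroup = record
      { isMagma = record { isEquivalence = Setoid.isEquivalence ≃-setoid ; ∙-cong = ⊓-cong }
      ; assoc   = ⊓-assoc
      }
    ; identity = (λ _ → ≃-refl) , ⊓-identityʳ
    }
  ; comm = ⊓-comm
  }

⇛-zeroʳ : ∀ x → x ⇛ nothing ≃ nothing
⇛-zeroʳ nothing  = nothing
⇛-zeroʳ (just _) = nothing

⇛-distribˡ-⊓ : ∀ x y z → x ⇛ (y ⊓ z) ≃ (x ⇛ y) ⊓ (x ⇛ z)
⇛-distribˡ-⊓ nothing  _        _        = ≃-refl
⇛-distribˡ-⊓ (just _) nothing  _        = ≃-refl
⇛-distribˡ-⊓ (just _) (just _) nothing  = ≃-refl
⇛-distribˡ-⊓ (just _) (just _) (just _) = just dist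

⋀ : List Prime → Maybe Type
⋀ = foldr _⊓_ nothing ∘ map (just ∘ ⟦_⟧ᵖ)

⋀-cong : ∀ {xs ys} → xs ↭ ys → ⋀ xs ≃ ⋀ ys
⋀-cong p = PermProperties.foldr-commMonoid ≃-setoid ⊓-isCommutativeMonoid
  (PermProperties.map⁺ ≈ᵖ-setoid ≃-setoid (just ∘ ⟦⟧ᵖ-cong) p)

⋀-++ : ∀ xs ys → ⋀ (xs ++ ys) ≃ ⋀ xs ⊓ ⋀ ys
⋀-++ []       ys = ≃-refl
⋀-++ (x ∷ xs) ys = ≃-trans (⊓-cong ≃-refl (⋀-++ xs ys)) (≃-sym (⊓-assoc _ (⋀ xs) (⋀ ys)))

⇒*-⋀ : ∀ X B → just (X ⇒* B) ≃ ⋀ X ⇛ just B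
⇒*-⋀ []      B = ≃-refl
⇒*-⋀ (x ∷ X) B with ⋀ X | ⇒*-⋀ X B
... | nothing | just e = just (≅-⇒ ≅-refl e)
... | just _  | just e = just (≅-trans (≅-⇒ ≅-refl e) (≅-sym curry))

⟦⇒ᵖ⟧ : ∀ X p → just ⟦ X ⇒ᵖ p ⟧ᵖ ≃ ⋀ X ⇛ just ⟦ p ⟧ᵖ
⟦⇒ᵖ⟧ X (as ⇒τ) rewrite ⇒*-++ X as τ = ⇒*-⋀ X (as ⇒* τ)

⋀-map-⇒ᵖ : ∀ X ps → ⋀ (map (X ⇒ᵖ_) ps) ≃ ⋀ X ⇛ ⋀ ps
⋀-map-⇒ᵖ X []       = ≃-sym (⇛-zeroʳ (⋀ X))
⋀-map-⇒ᵖ X (p ∷ ps) = begin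
  just ⟦ X ⇒ᵖ p ⟧ᵖ ⊓ ⋀ (map (X ⇒ᵖ_) ps)  ≈⟨ ⊓-cong (⟦⇒ᵖ⟧ X p) (⋀-map-⇒ᵖ X ps) ⟩
  (⋀ X ⇛ just ⟦ p ⟧ᵖ) ⊓ (⋀ X ⇛ ⋀ ps)     ≈⟨ ⇛-distribˡ-⊓ (⋀ X) _ (⋀ ps) ⟨
  ⋀ X ⇛ just ⟦ p ⟧ᵖ ⊓ ⋀ ps               ∎
  where open SetoidReasoning ≃-setoid

nf-sound : ∀ A → just A ≃ ⋀ (nf A)
nf-sound τ       = ≃-refl
nf-sound (A ∧ B) = ≃-trans (⊓-cong (nf-sound A) (nf-sound B)) (≃-sym (⋀-++ (nf A) (nf B)))
nf-sound (A ⇒ B) = ≃-trans (⇛-cong (nf-sound A) (nf-sound B)) (≃-sym (⋀-map-⇒ᵖ (nf A) (nf B)))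

nf↭⇒≅ : ∀ {A B} → nf A ↭ nf B → A ≅ B
nf↭⇒≅ {A} {B} p =
  Maybe.drop-just (≃-trans (nf-sound A) (≃-trans (⋀-cong p) (≃-sym (nf-sound B))))

⇒-cancelˡ : ∀ {A B B'} → A ⇒ B ≅ A ⇒ B' → B ≅ B'
⇒-cancelˡ {A} {B} e =
  nf↭⇒≅ (↭-map⁻ ≈ᵖ-setoid ≈ᵖ-setoid (⇒ᵖ-cancelˡ (nf A)) (nf B) (≅⇒nf↭ e))

lemma1 : (r : Term) (A B : Type) → r ∶ A → r ∶ B → A ≅ B
lemma1 r A B (ty-≅ d e) d′ = ≅-trans (≅-sym e) (lemma1 r _ B d d′)
lemma1 r A B d (ty-≅ d′ e) = ≅-trans (lemma1 r A _ d d′) e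
lemma1 _ _ _ ty-var ty-var = ≅-refl
lemma1 (lam _ _ s) _ _ (ty-lam d _) (ty-lam d′ _) = ≅-⇒ ≅-refl (lemma1 s _ _ d d′)
lemma1 (app r s) _ _ (ty-app d e _) (ty-app d′ e′ _) =
  ⇒-cancelˡ (≅-trans (lemma1 r _ _ d d′) (≅-⇒ (≅-sym (lemma1 s _ _ e e′)) ≅-refl))
lemma1 (plus r s) _ _ (ty-plus d e _) (ty-plus d′ e′ _) =
  ≅-∧ (lemma1 r _ _ d d′) (lemma1 s _ _ e e′)
lemma1 (proj _ _) _ _ (ty-proj _)  (ty-proj _)  = ≅-refl
lemma1 (proj _ _) _ _ (ty-proj _)  (ty-proj∧ _) = ≅-refl
lemma1 (proj _ _) _ _ (ty-proj∧ _) (ty-proj _)  = ≅-refl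
lemma1 (proj _ _) _ _ (ty-proj∧ _) (ty-proj∧ _) = ≅-refl
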